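{- For every $n\ge1$, the partition function of the dimer model on the loopless Schreier graph $\Sigma_n$ of the Basilica group, with positive weights $a,b$ on edges labeled $a,b$ respectively, is $$\Phi_n(a,b)=\begin{cases}2^{\frac{2^n+1}{3}}\,b^{2^{n-1}} & n\text{ odd},\\[2pt] 2^{\frac{2^n+2}{3}}\,b^{2^{n-1}} & n\text{ even}.\end{cases}$$
   Context: The Basilica group is generated by the maps $a,b$ on binary words defined recursively for any binary word $w$ by - $a(0w)=0\,b(w)$ and $a(1w)=1w$; - $b(0w)=1\,a(w)$ and $b(1w)=0w$. The loopless Schreier graph $\Sigma_n$ has vertex set $\{0,1\}^n$. For each $s\in\{a,b\}$ and each $u\in\{0,1\}^n$ with $s(u)\ne u$, it has one edge labeled $s$ joining $u$ to $s(u)$. In particular, an orbit $\{u,s(u)\}$ of size $2$ yields two parallel edges labeled $s$. An edge labeled $s$ has weight $s>0$. A dimer covering is a perfect matching of $\Sigma_n$, and its weight is the product of the weights of its edges. $\Phi_n(a,b)$ is the sum of the weights of all dimer coverings.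
   Formalization: The weights $a,b$ are positive rationals instead of positive reals. -}

module Defs where

open import Data.Bool using (Bool; true; false; if_then_else_)
import Data.Bool as B
open import Data.Nat as ℕ using (ℕ; zero; suc)
open import Data.Integer using (+_)
open import Data.Rational using (ℚ; 0ℚ; 1ℚ; _+_; _*_; _/_)
open import Data.Vec using (Vec; []; _∷_)
open import Data.Vec.Properties using (≡-dec)
open import Data.List using (List; []; _∷_; _++_; map; concatMap; filter; foldr; length; allFin)
open import Data.Product using (_×_; _,_)
open import Relation.Nullary using (does; ¬_)
open import Relation.Nullary.Decidable using (⌊_⌋)
open import Relation.Binary.PropositionalEquality using (_≡_)

-- Binary words of length n: false = letter 0, true = letter 1.
Word : ℕ → Set
Word n = Vec Bool n

mutual
  actA : ∀ {n} → Word n → Word n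
  actA []          = []
  actA (false ∷ w) = false ∷ actB w
  actA (true ∷ w)  = true ∷ w

  actB : ∀ {n} → Word n → Word n
  actB []          = []
  actB (false ∷ w) = true ∷ actA w
  actB (true ∷ w)  = false ∷ w

data Label : Set where
  la lb : Label

act : ∀ {n} → Label → Word n → Word n
act la = actA
act lb = actB

_≟w_ : ∀ {n} (u v : Word n) → Relation.Nullary.Dec (u ≡ v)
_≟w_ = ≡-dec B._≟_

words : (n : ℕ) → List (Word n)
words zero    = [] ∷ []
words (suc n) = map (false ∷_) (words n) ++ map (true ∷_) (words n)

-- An edge of Σ_n is a pair (s , u) with s(u) ≠ u; it joins u and s(u).
Edge : ℕ → Set
Edge n = Label × Word n

edges : (n : ℕ) → List (Edge n)
edges n = filter (λ e → Relation.Nullary.¬? (act (Data.Product.proj₁ e) (Data.Product.proj₂ e) ≟w Data.Product.proj₂ e))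
                 (concatMap (λ u → (la , u) ∷ (lb , u) ∷ []) (words n))

incident : ∀ {n} → Word n → Edge n → Bool
incident v (s , u) = does (v ≟w u) B.∨ does (v ≟w act s u)

sublists : ∀ {A : Set} → List A → List (List A)
sublists []       = [] ∷ []
sublists (x ∷ xs) = map (x ∷_) (sublists xs) ++ sublists xs

degree : ∀ {n} → List (Edge n) → Word n → ℕ
degree M v = length (filter (λ e → incident v e B.≟ true) M)

allB : ∀ {A : Set} → (A → Bool) → List A → Bool
allB p = foldr (λ x r → p x B.∧ r) true

isPerfect : ∀ {n} → List (Edge n) → Bool
isPerfect {n} M = allB (λ v → ⌊ degree M v ℕ.≟ 1 ⌋) (words n)

weight : ∀ {n} → ℚ → ℚ → Edge n → ℚ
weight a b (la , _) = a
weight a b (lb , _) = b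

prodℚ : List ℚ → ℚ
prodℚ = foldr _*_ 1ℚ

sumℚ : List ℚ → ℚ
sumℚ = foldr _+_ 0ℚ

Φ : (n : ℕ) → ℚ → ℚ → ℚ
Φ n a b = sumℚ (map (λ M → prodℚ (map (weight a b) M))
                    (filter (λ M → isPerfect M B.≟ true) (sublists (edges n))))

_^ℚ_ : ℚ → ℕ → ℚ
x ^ℚ zero  = 1ℚ
x ^ℚ suc k = x * (x ^ℚ k)

ℕtoℚ : ℕ → ℚ
ℕtoℚ k = + k / 1

isOdd : ℕ → Bool
isOdd zero = false
isOdd (suc k) = B.not (isOdd k)

{-# OPTIONS --safe #-}
-- An a-labelled edge joins 0w to 0b(w), so the vertices 1w can only be matched by b-edges.
-- Double counting (every b-edge has exactly one endpoint of the form 1w, every edge has two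
-- endpoints) then shows that a dimer covering of Σ_{n+1} consists of exactly 2^n b-edges;
-- hence Φ_{n+1}(a,b) = N · b^{2^n}, where N is the number of perfect matchings made of b-edges.
-- Writing such a matching as the set of u with (b, u) chosen, split into P = {w | 0w chosen}
-- and Q = {w | 1w chosen}, it is perfect iff a(P) = P and Q is the complement of P. So N is the
-- number A_n of a-invariant subsets of {0,1}^n. Splitting subsets by their first letter gives
-- A_{n+1} = B_n · 2^{2^n} (a acts as b on 0w and trivially on 1w) and B_{n+1} = A_n (b swaps
-- the halves through a), for the number B_n of b-invariant subsets; with A_0 = 2 and A_1 = 4
-- this yields the closed form.
module Submission where

open import Defs

module Combinatorics where

  open import Data.Bool as Bool using (Bool; true; false; _∧_; _∨_; if_then_else_)
  import Data.Bool.Properties as Boolₚ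
  open import Data.Nat as ℕ using (ℕ; zero; suc; _+_; _*_; _^_; _/_; _≤_)
  import Data.Nat.Properties as ℕₚ
  open import Algebra.Bundles using (CommutativeMonoid)
  open import Algebra.Properties.CommutativeSemigroup ℕₚ.+-commutativeSemigroup
    using () renaming (interchange to +-interchange)
  open import Algebra.Properties.CommutativeSemigroup (CommutativeMonoid.commutativeSemigroup Boolₚ.∧-commutativeMonoid)
    using () renaming (interchange to ∧-interchange)
  open import Data.Nat.DivMod using (+-distrib-/-∣ʳ; m*n/n≡m)
  open import Data.Nat.Divisibility using (divides-refl)
  open import Data.Nat.Solver using (module +-*-Solver)
  open import Data.List using (List; []; _∷_; _++_; map; filter; filterᵇ; concatMap; length)
  open import Data.Nat.ListAction using (sum)
  open import Data.Nat.ListAction.Properties using (sum-++)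
  import Data.List.Properties as Listₚ
  open import Data.List.Relation.Unary.All as All using (All; []; _∷_)
  import Data.List.Relation.Unary.All.Properties as Allₚ
  open import Data.Vec using ([]; _∷_)
  open import Data.Product using (_×_; _,_; proj₁)
  open import Data.Empty using (⊥; ⊥-elim)
  open import Function using (_∘_)
  open import Relation.Nullary using (Dec; does; yes; no; ¬_; ¬?)
  open import Relation.Nullary.Decidable using (⌊_⌋)
  open import Relation.Binary.PropositionalEquality
  open ≡-Reasoning

  private variable
    A B : Set
    n k : ℕ

  iverson : Bool → ℕ
  iverson false = 0
  iverson true  = 1

  countᵇ : (A → Bool) → List A → ℕ
  countᵇ p []       = 0
  countᵇ p (x ∷ xs) = iverson (p x) + countᵇ p xs

  length-filter-≟-true : (p : A → Bool) (xs : List A) →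
                         length (filter (λ x → p x Bool.≟ true) xs) ≡ countᵇ p xs
  length-filter-≟-true p []       = refl
  length-filter-≟-true p (x ∷ xs) with p x
  ... | true  = cong suc (length-filter-≟-true p xs)
  ... | false = length-filter-≟-true p xs

  countᵇ-cong : {p q : A → Bool} → (∀ x → p x ≡ q x) → (xs : List A) → countᵇ p xs ≡ countᵇ q xs
  countᵇ-cong p≗q []       = refl
  countᵇ-cong p≗q (x ∷ xs) = cong₂ _+_ (cong iverson (p≗q x)) (countᵇ-cong p≗q xs)

  countᵇ-false : (xs : List A) → countᵇ (λ _ → false) xs ≡ 0
  countᵇ-false []       = refl
  countᵇ-false (x ∷ xs) = countᵇ-false xs

  countᵇ-true : (xs : List A) → countᵇ (λ _ → true) xs ≡ length xs
  countᵇ-true []       = refl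
  countᵇ-true (x ∷ xs) = cong suc (countᵇ-true xs)

  countᵇ-++ : (p : A → Bool) (xs ys : List A) → countᵇ p (xs ++ ys) ≡ countᵇ p xs + countᵇ p ys
  countᵇ-++ p []       ys = refl
  countᵇ-++ p (x ∷ xs) ys = trans (cong (iverson (p x) +_) (countᵇ-++ p xs ys))
                                 (sym (ℕₚ.+-assoc (iverson (p x)) _ _))

  countᵇ-map : (p : B → Bool) (f : A → B) (xs : List A) → countᵇ p (map f xs) ≡ countᵇ (p ∘ f) xs
  countᵇ-map p f []       = refl
  countᵇ-map p f (x ∷ xs) = cong (iverson (p (f x)) +_) (countᵇ-map p f xs)

  countᵇ-∨-disjoint : (p q : A → Bool) → (∀ x → p x ∧ q x ≡ false) → (xs : List A) →
                      countᵇ (λ x → p x ∨ q x) xs ≡ countᵇ p xs + countᵇ q xs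
  countᵇ-∨-disjoint p q disjoint []       = refl
  countᵇ-∨-disjoint p q disjoint (x ∷ xs) with p x | q x | disjoint x
  ... | true  | false | _ = cong suc (countᵇ-∨-disjoint p q disjoint xs)
  ... | false | true  | _ = trans (cong suc (countᵇ-∨-disjoint p q disjoint xs))
                                  (sym (ℕₚ.+-suc (countᵇ p xs) (countᵇ q xs)))
  ... | false | false | _ = countᵇ-∨-disjoint p q disjoint xs

  countᵇ-∨-false : (p : A → Bool) (xs : List A) → countᵇ (λ x → p x ∨ false) xs ≡ countᵇ p xs
  countᵇ-∨-false p = countᵇ-cong (λ x → Boolₚ.∨-identityʳ (p x))

  countᵇ-const-∧ : (b : Bool) (q : A → Bool) (xs : List A) →
                   countᵇ (λ x → b ∧ q x) xs ≡ iverson b * countᵇ q xs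
  countᵇ-const-∧ true  q xs = sym (ℕₚ.+-identityʳ (countᵇ q xs))
  countᵇ-const-∧ false q xs = countᵇ-false xs

  countᵇ≤length : (p : A → Bool) (xs : List A) → countᵇ p xs ≤ length xs
  countᵇ≤length p []       = ℕ.z≤n
  countᵇ≤length p (x ∷ xs) with p x
  ... | true  = ℕ.s≤s (countᵇ≤length p xs)
  ... | false = ℕₚ.m≤n⇒m≤1+n (countᵇ≤length p xs)

  countᵇ≡length⇒All : (p : A → Bool) (xs : List A) → countᵇ p xs ≡ length xs → All (λ x → p x ≡ true) xs
  countᵇ≡length⇒All p []       _  = []
  countᵇ≡length⇒All p (x ∷ xs) eq with p x in px
  ... | true  = px ∷ countᵇ≡length⇒All p xs (ℕₚ.suc-injective eq)
  ... | false = ⊥-elim (ℕₚ.<⇒≱ ℕₚ.≤-refl (subst (_≤ length xs) eq (countᵇ≤length p xs)))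

  sum-map-cong : {f g : A → ℕ} {xs : List A} → All (λ x → f x ≡ g x) xs → sum (map f xs) ≡ sum (map g xs)
  sum-map-cong []             = refl
  sum-map-cong (fx≡gx ∷ rest) = cong₂ _+_ fx≡gx (sum-map-cong rest)

  sum-map-const : {f : A → ℕ} {xs : List A} → All (λ x → f x ≡ k) xs → sum (map f xs) ≡ length xs * k
  sum-map-const []            = refl
  sum-map-const (fx≡k ∷ rest) = cong₂ _+_ fx≡k (sum-map-const rest)

  sum-map-+ : (f g : A → ℕ) (xs : List A) → sum (map (λ x → f x + g x) xs) ≡ sum (map f xs) + sum (map g xs)
  sum-map-+ f g []       = refl
  sum-map-+ f g (x ∷ xs) = trans (cong (f x + g x +_) (sum-map-+ f g xs)) (+-interchange (f x) (g x) _ _)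

  sum-map-iverson : (p : A → Bool) (xs : List A) → sum (map (iverson ∘ p) xs) ≡ countᵇ p xs
  sum-map-iverson p []       = refl
  sum-map-iverson p (x ∷ xs) = cong (iverson (p x) +_) (sum-map-iverson p xs)

  sum-countᵇ-comm : (r : A → B → Bool) (xs : List A) (ys : List B) →
    sum (map (λ x → countᵇ (r x) ys) xs) ≡ sum (map (λ y → countᵇ (λ x → r x y) xs) ys)
  sum-countᵇ-comm r xs []       =
    trans (sum-map-const {f = λ x → countᵇ (r x) []} {xs} (All.tabulate (λ _ → refl))) (ℕₚ.*-zeroʳ (length xs))
  sum-countᵇ-comm r xs (y ∷ ys) = begin
    sum (map (λ x → iverson (r x y) + countᵇ (r x) ys) xs)
      ≡⟨ sum-map-+ (λ x → iverson (r x y)) (λ x → countᵇ (r x) ys) xs ⟩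
    sum (map (λ x → iverson (r x y)) xs) + sum (map (λ x → countᵇ (r x) ys) xs)
      ≡⟨ cong₂ _+_ (sum-map-iverson (λ x → r x y) xs) (sum-countᵇ-comm r xs ys) ⟩
    countᵇ (λ x → r x y) xs + sum (map (λ y → countᵇ (λ x → r x y) xs) ys) ∎

  length-by-double-counting : (r : A → B → Bool) (xs : List A) (ys : List B) →
    All (λ x → countᵇ (r x) ys ≡ 1) xs → length xs ≡ sum (map (λ y → countᵇ (λ x → r x y) xs) ys)
  length-by-double-counting r xs ys unique = begin
    length xs                               ≡⟨ sym (ℕₚ.*-identityʳ (length xs)) ⟩
    length xs * 1                           ≡⟨ sym (sum-map-const unique) ⟩
    sum (map (λ x → countᵇ (r x) ys) xs)    ≡⟨ sum-countᵇ-comm r xs ys ⟩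
    sum (map (λ y → countᵇ (λ x → r x y) xs) ys) ∎

  sum-countᵇ-∧ : {xs : List A} {ys : List B} (F : A → B → Bool) (f : A → Bool) (g : A → B → Bool) →
    (∀ x y → F x y ≡ f x ∧ g x y) → All (λ x → countᵇ (g x) ys ≡ k) xs →
    sum (map (λ x → countᵇ (F x) ys) xs) ≡ countᵇ f xs * k
  sum-countᵇ-∧                     F f g F≡f∧g []          = refl
  sum-countᵇ-∧ {k = k} {x ∷ xs} {ys} F f g F≡f∧g (gx≡k ∷ rest) = begin
    countᵇ (F x) ys + sum (map (λ x → countᵇ (F x) ys) xs)
      ≡⟨ cong₂ _+_ (countᵇ-cong (F≡f∧g x) ys) (sum-countᵇ-∧ {ys = ys} F f g F≡f∧g rest) ⟩
    countᵇ (λ y → f x ∧ g x y) ys + countᵇ f xs * k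
      ≡⟨ cong (_+ countᵇ f xs * k) (trans (countᵇ-const-∧ (f x) (g x) ys) (cong (iverson (f x) *_) gx≡k)) ⟩
    iverson (f x) * k + countᵇ f xs * k
      ≡⟨ sym (ℕₚ.*-distribʳ-+ k (iverson (f x)) (countᵇ f xs)) ⟩
    countᵇ f (x ∷ xs) * k ∎


  allB-++ : (p : A → Bool) (xs ys : List A) → allB p (xs ++ ys) ≡ allB p xs ∧ allB p ys
  allB-++ p []       ys = refl
  allB-++ p (x ∷ xs) ys = trans (cong (p x ∧_) (allB-++ p xs ys)) (sym (Boolₚ.∧-assoc (p x) _ _))

  allB-map : (p : B → Bool) (f : A → B) (xs : List A) → allB p (map f xs) ≡ allB (p ∘ f) xs
  allB-map p f []       = refl
  allB-map p f (x ∷ xs) = cong (p (f x) ∧_) (allB-map p f xs)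

  allB-cong : {p q : A → Bool} → (∀ x → p x ≡ q x) → (xs : List A) → allB p xs ≡ allB q xs
  allB-cong p≗q []       = refl
  allB-cong p≗q (x ∷ xs) = cong₂ _∧_ (p≗q x) (allB-cong p≗q xs)

  allB-∧ : (p q : A → Bool) (xs : List A) → allB (λ x → p x ∧ q x) xs ≡ allB p xs ∧ allB q xs
  allB-∧ p q []       = refl
  allB-∧ p q (x ∷ xs) = trans (cong ((p x ∧ q x) ∧_) (allB-∧ p q xs)) (∧-interchange (p x) (q x) _ _)

  allB-true : (xs : List A) → allB (λ _ → true) xs ≡ true
  allB-true []       = refl
  allB-true (x ∷ xs) = allB-true xs

  allB⇒All : (p : A → Bool) (xs : List A) → allB p xs ≡ true → All (λ x → p x ≡ true) xs
  allB⇒All p []       _     = []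
  allB⇒All p (x ∷ xs) holds with p x in px
  ... | true = px ∷ allB⇒All p xs holds


  sublists-map : (f : A → B) (xs : List A) → sublists (map f xs) ≡ map (map f) (sublists xs)
  sublists-map f []       = refl
  sublists-map f (x ∷ xs) = begin
    map (f x ∷_) (sublists (map f xs)) ++ sublists (map f xs)
      ≡⟨ cong (λ S → map (f x ∷_) S ++ S) (sublists-map f xs) ⟩
    map (f x ∷_) (map (map f) (sublists xs)) ++ map (map f) (sublists xs)
      ≡⟨ cong (_++ map (map f) (sublists xs))
              (trans (sym (Listₚ.map-∘ (sublists xs))) (Listₚ.map-∘ (sublists xs))) ⟩
    map (map f) (map (x ∷_) (sublists xs)) ++ map (map f) (sublists xs)
      ≡⟨ sym (Listₚ.map-++ (map f) (map (x ∷_) (sublists xs)) (sublists xs)) ⟩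
    map (map f) (sublists (x ∷ xs)) ∎

  length-sublists : (xs : List A) → length (sublists xs) ≡ 2 ^ length xs
  length-sublists []       = refl
  length-sublists (x ∷ xs) = begin
    length (map (x ∷_) (sublists xs) ++ sublists xs)
      ≡⟨ Listₚ.length-++ (map (x ∷_) (sublists xs)) ⟩
    length (map (x ∷_) (sublists xs)) + length (sublists xs)
      ≡⟨ cong (_+ length (sublists xs)) (Listₚ.length-map (x ∷_) (sublists xs)) ⟩
    length (sublists xs) + length (sublists xs)
      ≡⟨ cong (λ l → l + l) (length-sublists xs) ⟩
    2 ^ length xs + 2 ^ length xs
      ≡⟨ cong (2 ^ length xs +_) (sym (ℕₚ.+-identityʳ (2 ^ length xs))) ⟩
    2 ^ suc (length xs) ∎

  All-sublists : {P : A → Set} {xs : List A} → All P xs → All (All P) (sublists xs)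
  All-sublists []           = [] ∷ []
  All-sublists (px ∷ pxs) = Allₚ.++⁺ (Allₚ.map⁺ (All.map (px ∷_) (All-sublists pxs))) (All-sublists pxs)

  countᵇ-sublists-∷ : (F : List A → Bool) (x : A) (xs : List A) →
    countᵇ F (sublists (x ∷ xs)) ≡ countᵇ (F ∘ (x ∷_)) (sublists xs) + countᵇ F (sublists xs)
  countᵇ-sublists-∷ F x xs = trans (countᵇ-++ F (map (x ∷_) (sublists xs)) (sublists xs))
                                   (cong (_+ countᵇ F (sublists xs)) (countᵇ-map F (x ∷_) (sublists xs)))

  sum-map-sublists-∷ : (G : List A → ℕ) (x : A) (xs : List A) →
    sum (map G (sublists (x ∷ xs))) ≡ sum (map (G ∘ (x ∷_)) (sublists xs)) + sum (map G (sublists xs))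
  sum-map-sublists-∷ G x xs = begin
    sum (map G (map (x ∷_) (sublists xs) ++ sublists xs))
      ≡⟨ cong sum (Listₚ.map-++ G (map (x ∷_) (sublists xs)) (sublists xs)) ⟩
    sum (map G (map (x ∷_) (sublists xs)) ++ map G (sublists xs))
      ≡⟨ sum-++ (map G (map (x ∷_) (sublists xs))) (map G (sublists xs)) ⟩
    sum (map G (map (x ∷_) (sublists xs))) + sum (map G (sublists xs))
      ≡⟨ cong (λ l → sum l + sum (map G (sublists xs))) (sym (Listₚ.map-∘ (sublists xs))) ⟩
    sum (map (G ∘ (x ∷_)) (sublists xs)) + sum (map G (sublists xs)) ∎

  All-sublists-∷⁻ : {R : List A → Set} (x : A) (xs : List A) →
    All R (sublists (x ∷ xs)) → All (R ∘ (x ∷_)) (sublists xs) × All R (sublists xs)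
  All-sublists-∷⁻ x xs holds = Allₚ.map⁻ (Allₚ.++⁻ˡ (map (x ∷_) (sublists xs)) holds) ,
                               Allₚ.++⁻ʳ (map (x ∷_) (sublists xs)) holds

  countᵇ-sublists-++ : (F : List A → Bool) (xs ys : List A) →
    countᵇ F (sublists (xs ++ ys)) ≡ sum (map (λ S → countᵇ (λ T → F (S ++ T)) (sublists ys)) (sublists xs))
  countᵇ-sublists-++ F []       ys = sym (ℕₚ.+-identityʳ _)
  countᵇ-sublists-++ F (x ∷ xs) ys = begin
    countᵇ F (sublists (x ∷ xs ++ ys))
      ≡⟨ countᵇ-sublists-∷ F x (xs ++ ys) ⟩
    countᵇ (F ∘ (x ∷_)) (sublists (xs ++ ys)) + countᵇ F (sublists (xs ++ ys))
      ≡⟨ cong₂ _+_ (countᵇ-sublists-++ (F ∘ (x ∷_)) xs ys) (countᵇ-sublists-++ F xs ys) ⟩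
    sum (map (G ∘ (x ∷_)) (sublists xs)) + sum (map G (sublists xs))
      ≡⟨ sym (sum-map-sublists-∷ G x xs) ⟩
    sum (map G (sublists (x ∷ xs))) ∎
    where
    G : List _ → ℕ
    G S = countᵇ (λ T → F (S ++ T)) (sublists ys)

  All-sublists-++ : (R : List A → Set) (xs ys : List A) →
    All (λ S → All (λ T → R (S ++ T)) (sublists ys)) (sublists xs) → All R (sublists (xs ++ ys))
  All-sublists-++ R []       ys (holds ∷ []) = holds
  All-sublists-++ R (x ∷ xs) ys holds with All-sublists-∷⁻ x xs holds
  ... | with-x , without-x = Allₚ.++⁺ (Allₚ.map⁺ (All-sublists-++ (R ∘ (x ∷_)) xs ys with-x))
                                      (All-sublists-++ R xs ys without-x)

  countᵇ-none : {p : A → Bool} {xs : List A} → All (λ x → p x ≡ false) xs → countᵇ p xs ≡ 0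
  countᵇ-none []            = refl
  countᵇ-none (px≡false ∷ rest) rewrite px≡false = countᵇ-none rest

  countᵇ-sublists-filterᵇ : (F : List A → Bool) (q : A → Bool) (xs : List A) →
    All (λ S → F S ≡ true → All (λ x → q x ≡ true) S) (sublists xs) →
    countᵇ F (sublists xs) ≡ countᵇ F (sublists (filterᵇ q xs))
  countᵇ-sublists-filterᵇ F q []       _   = refl
  countᵇ-sublists-filterᵇ F q (x ∷ xs) F⇒q with All-sublists-∷⁻ x xs F⇒q | q x in qx
  ... | with-x , without-x | false = trans (countᵇ-sublists-∷ F x xs)
    (cong₂ _+_ (countᵇ-none (All.map (λ F⇒q-xS → Boolₚ.¬-not (λ FxS → rejected (All.head (F⇒q-xS FxS)))) with-x))
               (countᵇ-sublists-filterᵇ F q xs without-x))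
    where
    rejected : q x ≡ true → ⊥
    rejected qx≡true with () ← trans (sym qx≡true) qx
  ... | with-x , without-x | true = begin
    countᵇ F (sublists (x ∷ xs))
      ≡⟨ countᵇ-sublists-∷ F x xs ⟩
    countᵇ (F ∘ (x ∷_)) (sublists xs) + countᵇ F (sublists xs)
      ≡⟨ cong₂ _+_ (countᵇ-sublists-filterᵇ (F ∘ (x ∷_)) q xs (All.map (All.tail ∘_) with-x))
                   (countᵇ-sublists-filterᵇ F q xs without-x) ⟩
    countᵇ (F ∘ (x ∷_)) (sublists (filterᵇ q xs)) + countᵇ F (sublists (filterᵇ q xs))
      ≡⟨ sym (countᵇ-sublists-∷ F x (filterᵇ q xs)) ⟩
    countᵇ F (sublists (x ∷ filterᵇ q xs)) ∎

  -- Words and the edges of Σ_n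

  length-words : (n : ℕ) → length (words n) ≡ 2 ^ n
  length-words zero    = refl
  length-words (suc n) = begin
    length (map (false ∷_) (words n) ++ map (true ∷_) (words n))
      ≡⟨ Listₚ.length-++ (map (false ∷_) (words n)) ⟩
    length (map (false ∷_) (words n)) + length (map (true ∷_) (words n))
      ≡⟨ cong₂ _+_ (Listₚ.length-map (false ∷_) (words n)) (Listₚ.length-map (true ∷_) (words n)) ⟩
    length (words n) + length (words n)
      ≡⟨ cong (λ l → l + l) (length-words n) ⟩
    2 ^ n + 2 ^ n
      ≡⟨ cong (2 ^ n +_) (sym (ℕₚ.+-identityʳ (2 ^ n))) ⟩
    2 ^ suc n ∎

  allB-words-suc : (p : Word (suc n) → Bool) →
    allB p (words (suc n)) ≡ allB (p ∘ (false ∷_)) (words n) ∧ allB (p ∘ (true ∷_)) (words n)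
  allB-words-suc {n} p = trans (allB-++ p (map (false ∷_) (words n)) (map (true ∷_) (words n)))
                               (cong₂ _∧_ (allB-map p (false ∷_) (words n)) (allB-map p (true ∷_) (words n)))

  join : List (Word n) → List (Word n) → List (Word (suc n))
  join P Q = map (false ∷_) P ++ map (true ∷_) Q

  countᵇ-join : (p : Word (suc n) → Bool) (P Q : List (Word n)) →
    countᵇ p (join P Q) ≡ countᵇ (p ∘ (false ∷_)) P + countᵇ (p ∘ (true ∷_)) Q
  countᵇ-join p P Q = trans (countᵇ-++ p (map (false ∷_) P) (map (true ∷_) Q))
                            (cong₂ _+_ (countᵇ-map p (false ∷_) P) (countᵇ-map p (true ∷_) Q))

  countᵇ-≟w-words : (n : ℕ) (x : Word n) → countᵇ (λ w → does (w ≟w x)) (words n) ≡ 1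
  countᵇ-≟w-words zero    []          = refl
  countᵇ-≟w-words (suc n) (false ∷ x) = trans (countᵇ-join _ (words n) (words n))
                                              (cong₂ _+_ (countᵇ-≟w-words n x) (countᵇ-false (words n)))
  countᵇ-≟w-words (suc n) (true ∷ x)  = trans (countᵇ-join _ (words n) (words n))
                                              (cong₂ _+_ (countᵇ-false (words n)) (countᵇ-≟w-words n x))

  Loopless : Edge n → Set
  Loopless (s , u) = ¬ (act s u ≡ u)

  -- The decision procedure by which `edges` filters, so that `edges n` is literally a filter by it.
  loopless? : (e : Edge n) → Dec (Loopless e)
  loopless? (s , u) = ¬? (act s u ≟w u)

  edges-loopless : (n : ℕ) → All Loopless (edges n)
  edges-loopless n = Allₚ.all-filter loopless? (concatMap (λ u → (la , u) ∷ (lb , u) ∷ []) (words n))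

  labelledB : Edge n → Bool
  labelledB (la , _) = false
  labelledB (lb , _) = true

  filterᵇ-labelledB-∷-b : (u : Word (suc n)) {es : List (Edge (suc n))} {us : List (Word (suc n))} →
    filterᵇ labelledB (filter loopless? es) ≡ map (lb ,_) us →
    filterᵇ labelledB (filter loopless? ((lb , u) ∷ es)) ≡ map (lb ,_) (u ∷ us)
  filterᵇ-labelledB-∷-b (false ∷ w) = cong ((lb , false ∷ w) ∷_)
  filterᵇ-labelledB-∷-b (true ∷ w)  = cong ((lb , true ∷ w) ∷_)

  filterᵇ-labelledB-edges : (us : List (Word (suc n))) →
    filterᵇ labelledB (filter loopless? (concatMap (λ u → (la , u) ∷ (lb , u) ∷ []) us)) ≡ map (lb ,_) us
  filterᵇ-labelledB-edges []       = refl
  filterᵇ-labelledB-edges (u ∷ us) with does (loopless? (la , u))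
  ... | true  = filterᵇ-labelledB-∷-b u (filterᵇ-labelledB-edges us)
  ... | false = filterᵇ-labelledB-∷-b u (filterᵇ-labelledB-edges us)

  endpoints-loopless : (e : Edge n) → Loopless e → countᵇ (λ v → incident v e) (words n) ≡ 2
  endpoints-loopless {n} (s , u) loopless =
    trans (countᵇ-∨-disjoint (λ v → does (v ≟w u)) (λ v → does (v ≟w act s u)) distinct (words n))
          (cong₂ _+_ (countᵇ-≟w-words n u) (countᵇ-≟w-words n (act s u)))
    where
    distinct : ∀ v → does (v ≟w u) ∧ does (v ≟w act s u) ≡ false
    distinct v with v ≟w u | v ≟w act s u
    ... | yes refl | yes v≡su = ⊥-elim (loopless (sym v≡su))
    ... | yes _    | no _     = refl
    ... | no _     | _        = refl

  upper-endpoints-loopless : (e : Edge (suc n)) → Loopless e →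
    countᵇ (λ w → incident (true ∷ w) e) (words n) ≡ iverson (labelledB e)
  upper-endpoints-loopless {n} (la , false ∷ w) _        = countᵇ-false (words n)
  upper-endpoints-loopless {n} (la , true ∷ w)  loopless = ⊥-elim (loopless refl)
  upper-endpoints-loopless {n} (lb , false ∷ w) _        = countᵇ-≟w-words n (actA w)
  upper-endpoints-loopless {n} (lb , true ∷ w)  _        =
    trans (countᵇ-∨-false (λ v → does (v ≟w w)) (words n)) (countᵇ-≟w-words n w)

  degrees-perfect : (M : List (Edge n)) → isPerfect M ≡ true →
                    All (λ v → countᵇ (incident v) M ≡ 1) (words n)
  degrees-perfect {n} M perfect =
    All.map (λ {v} deg≡1 → trans (sym (length-filter-≟-true (incident v) M)) (≟1-sound deg≡1))
            (allB⇒All _ (words n) perfect)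
    where
    ≟1-sound : {d : ℕ} → ⌊ d ℕ.≟ 1 ⌋ ≡ true → d ≡ 1
    ≟1-sound {d} holds with d ℕ.≟ 1
    ... | yes d≡1 = d≡1

  perfect⇒b-edges : (M : List (Edge (suc n))) → All Loopless M → isPerfect M ≡ true →
                    All (λ e → labelledB e ≡ true) M × length M ≡ 2 ^ n
  perfect⇒b-edges {n} M loopless perfect = all-b , length-M
    where
    degrees = degrees-perfect M perfect

    twice : 2 ^ suc n ≡ length M * 2
    twice = begin
      2 ^ suc n
        ≡⟨ sym (length-words (suc n)) ⟩
      length (words (suc n))
        ≡⟨ length-by-double-counting incident (words (suc n)) M degrees ⟩
      sum (map (λ e → countᵇ (λ v → incident v e) (words (suc n))) M)
        ≡⟨ sum-map-const (All.map (λ {e} → endpoints-loopless e) loopless) ⟩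
      length M * 2 ∎

    upper : 2 ^ n ≡ countᵇ labelledB M
    upper = begin
      2 ^ n
        ≡⟨ sym (length-words n) ⟩
      length (words n)
        ≡⟨ length-by-double-counting (λ w → incident (true ∷ w)) (words n) M
             (Allₚ.map⁻ (Allₚ.++⁻ʳ (map (false ∷_) (words n)) degrees)) ⟩
      sum (map (λ e → countᵇ (λ w → incident (true ∷ w) e) (words n)) M)
        ≡⟨ sum-map-cong (All.map (λ {e} → upper-endpoints-loopless e) loopless) ⟩
      sum (map (iverson ∘ labelledB) M)
        ≡⟨ sum-map-iverson labelledB M ⟩
      countᵇ labelledB M ∎

    length-M : length M ≡ 2 ^ n
    length-M = ℕₚ.*-cancelʳ-≡ (length M) (2 ^ n) 2 (trans (sym twice) (ℕₚ.*-comm 2 (2 ^ n)))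

    all-b = countᵇ≡length⇒All labelledB M (trans (sym upper) (sym length-M))

  subsets : (n : ℕ) → List (List (Word n))
  subsets n = sublists (words n)

  length-subsets : (n : ℕ) → length (subsets n) ≡ 2 ^ 2 ^ n
  length-subsets n = trans (length-sublists (words n)) (cong (2 ^_) (length-words n))

  countᵇ-subsets-suc : (F : List (Word (suc n)) → Bool) →
    countᵇ F (subsets (suc n)) ≡ sum (map (λ P → countᵇ (λ Q → F (join P Q)) (subsets n)) (subsets n))
  countᵇ-subsets-suc {n} F = begin
    countᵇ F (sublists (map (false ∷_) (words n) ++ map (true ∷_) (words n)))
      ≡⟨ countᵇ-sublists-++ F (map (false ∷_) (words n)) (map (true ∷_) (words n)) ⟩
    sum (map G (sublists (map (false ∷_) (words n))))
      ≡⟨ cong (sum ∘ map G) (sublists-map (false ∷_) (words n)) ⟩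
    sum (map G (map (map (false ∷_)) (subsets n)))
      ≡⟨ cong sum (sym (Listₚ.map-∘ (subsets n))) ⟩
    sum (map (G ∘ map (false ∷_)) (subsets n))
      ≡⟨ sum-map-cong {xs = subsets n} (All.tabulate (λ {P} _ →
           trans (cong (countᵇ (F ∘ (map (false ∷_) P ++_))) (sublists-map (true ∷_) (words n)))
                 (countᵇ-map _ (map (true ∷_)) (subsets n)))) ⟩
    sum (map (λ P → countᵇ (λ Q → F (join P Q)) (subsets n)) (subsets n)) ∎
    where
    G : List (Word (suc n)) → ℕ
    G S = countᵇ (λ T → F (S ++ T)) (sublists (map (true ∷_) (words n)))

  countᵇ-subsets-suc-∧ : (F : List (Word (suc n)) → Bool) (f : List (Word n) → Bool)
    (g : List (Word n) → List (Word n) → Bool) → (∀ P Q → F (join P Q) ≡ f P ∧ g P Q) →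
    All (λ P → countᵇ (g P) (subsets n) ≡ k) (subsets n) → countᵇ F (subsets (suc n)) ≡ countᵇ f (subsets n) * k
  countᵇ-subsets-suc-∧ F f g F≡f∧g count-g =
    trans (countᵇ-subsets-suc F)
          (sum-countᵇ-∧ {xs = subsets _} {subsets _} (λ P Q → F (join P Q)) f g F≡f∧g count-g)

  All-subsets-suc : (R : List (Word (suc n)) → Set) →
    All (λ P → All (λ Q → R (join P Q)) (subsets n)) (subsets n) → All R (subsets (suc n))
  All-subsets-suc {n} R holds =
    All-sublists-++ R (map (false ∷_) (words n)) (map (true ∷_) (words n))
      (subst (All _) (sym (sublists-map (false ∷_) (words n)))
        (Allₚ.map⁺ (All.map (λ holds-P → subst (All _) (sym (sublists-map (true ∷_) (words n)))
                                                (Allₚ.map⁺ holds-P))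
                            holds)))

  multiplicity : Word n → List (Word n) → ℕ
  multiplicity w S = countᵇ (λ s → does (w ≟w s)) S

  pointwise : (ℕ → ℕ → Bool) → List (Word n) → List (Word n) → Bool
  pointwise {n} R S T = allB (λ w → R (multiplicity w S) (multiplicity w T)) (words n)

  isInvariant : (Word n → Word n) → List (Word n) → Bool
  isInvariant σ S = pointwise (λ x y → ⌊ x ℕ.≟ y ⌋) (map σ S) S

  module _ (P Q : List (Word n)) where

    multiplicity-join-false : (w : Word n) → multiplicity (false ∷ w) (join P Q) ≡ multiplicity w P
    multiplicity-join-false w = trans (countᵇ-join _ P Q)
      (trans (cong (multiplicity w P +_) (countᵇ-false Q)) (ℕₚ.+-identityʳ (multiplicity w P)))

    multiplicity-join-true : (w : Word n) → multiplicity (true ∷ w) (join P Q) ≡ multiplicity w Q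
    multiplicity-join-true w = trans (countᵇ-join _ P Q) (cong (_+ multiplicity w Q) (countᵇ-false P))

    multiplicity-actA-join-false : (w : Word n) →
      multiplicity (false ∷ w) (map actA (join P Q)) ≡ multiplicity w (map actB P)
    multiplicity-actA-join-false w = begin
      multiplicity (false ∷ w) (map actA (join P Q))
        ≡⟨ trans (countᵇ-map _ actA (join P Q)) (countᵇ-join _ P Q) ⟩
      countᵇ (λ p → does (w ≟w actB p)) P + countᵇ (λ _ → false) Q
        ≡⟨ cong₂ _+_ (sym (countᵇ-map _ actB P)) (countᵇ-false Q) ⟩
      multiplicity w (map actB P) + 0
        ≡⟨ ℕₚ.+-identityʳ _ ⟩
      multiplicity w (map actB P) ∎

    multiplicity-actA-join-true : (w : Word n) → multiplicity (true ∷ w) (map actA (join P Q)) ≡ multiplicity w Q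
    multiplicity-actA-join-true w = trans (trans (countᵇ-map _ actA (join P Q)) (countᵇ-join _ P Q))
                                          (cong (_+ multiplicity w Q) (countᵇ-false P))

    multiplicity-actB-join-false : (w : Word n) → multiplicity (false ∷ w) (map actB (join P Q)) ≡ multiplicity w Q
    multiplicity-actB-join-false w = trans (trans (countᵇ-map _ actB (join P Q)) (countᵇ-join _ P Q))
                                           (cong (_+ multiplicity w Q) (countᵇ-false P))

    multiplicity-actB-join-true : (w : Word n) →
      multiplicity (true ∷ w) (map actB (join P Q)) ≡ multiplicity w (map actA P)
    multiplicity-actB-join-true w = begin
      multiplicity (true ∷ w) (map actB (join P Q))
        ≡⟨ trans (countᵇ-map _ actB (join P Q)) (countᵇ-join _ P Q) ⟩
      countᵇ (λ p → does (w ≟w actA p)) P + countᵇ (λ _ → false) Q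
        ≡⟨ cong₂ _+_ (sym (countᵇ-map _ actA P)) (countᵇ-false Q) ⟩
      multiplicity w (map actA P) + 0
        ≡⟨ ℕₚ.+-identityʳ _ ⟩
      multiplicity w (map actA P) ∎

    degree-b-join-false : (w : Word n) →
      degree (map (lb ,_) (join P Q)) (false ∷ w) ≡ multiplicity w P + multiplicity w Q
    degree-b-join-false w = begin
      degree (map (lb ,_) (join P Q)) (false ∷ w)
        ≡⟨ length-filter-≟-true (incident (false ∷ w)) (map (lb ,_) (join P Q)) ⟩
      countᵇ (incident (false ∷ w)) (map (lb ,_) (join P Q))
        ≡⟨ trans (countᵇ-map (incident (false ∷ w)) (lb ,_) (join P Q)) (countᵇ-join _ P Q) ⟩
      countᵇ (λ p → does (w ≟w p) ∨ false) P + multiplicity w Q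
        ≡⟨ cong (_+ multiplicity w Q) (countᵇ-∨-false _ P) ⟩
      multiplicity w P + multiplicity w Q ∎

    degree-b-join-true : (w : Word n) →
      degree (map (lb ,_) (join P Q)) (true ∷ w) ≡ multiplicity w (map actA P) + multiplicity w Q
    degree-b-join-true w = begin
      degree (map (lb ,_) (join P Q)) (true ∷ w)
        ≡⟨ length-filter-≟-true (incident (true ∷ w)) (map (lb ,_) (join P Q)) ⟩
      countᵇ (incident (true ∷ w)) (map (lb ,_) (join P Q))
        ≡⟨ trans (countᵇ-map (incident (true ∷ w)) (lb ,_) (join P Q)) (countᵇ-join _ P Q) ⟩
      countᵇ (λ p → does (w ≟w actA p)) P + countᵇ (λ q → does (w ≟w q) ∨ false) Q
        ≡⟨ cong₂ _+_ (sym (countᵇ-map _ actA P)) (countᵇ-∨-false _ Q) ⟩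
      multiplicity w (map actA P) + multiplicity w Q ∎

  pointwise-halves : (R : ℕ → ℕ → Bool) (S T : List (Word (suc n))) (S₀ T₀ S₁ T₁ : List (Word n)) →
    (∀ w → multiplicity (false ∷ w) S ≡ multiplicity w S₀) → (∀ w → multiplicity (false ∷ w) T ≡ multiplicity w T₀) →
    (∀ w → multiplicity (true ∷ w) S ≡ multiplicity w S₁) → (∀ w → multiplicity (true ∷ w) T ≡ multiplicity w T₁) →
    pointwise R S T ≡ pointwise R S₀ T₀ ∧ pointwise R S₁ T₁
  pointwise-halves {n} R S T S₀ T₀ S₁ T₁ S≗S₀ T≗T₀ S≗S₁ T≗T₁ =
    trans (allB-words-suc (λ v → R (multiplicity v S) (multiplicity v T)))
          (cong₂ _∧_ (allB-cong (λ w → cong₂ R (S≗S₀ w) (T≗T₀ w)) (words n))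
                     (allB-cong (λ w → cong₂ R (S≗S₁ w) (T≗T₁ w)) (words n)))

  pointwise-join : (R : ℕ → ℕ → Bool) (P Q P′ Q′ : List (Word n)) →
    pointwise R (join P Q) (join P′ Q′) ≡ pointwise R P P′ ∧ pointwise R Q Q′
  pointwise-join R P Q P′ Q′ = pointwise-halves R (join P Q) (join P′ Q′) P P′ Q Q′
    (multiplicity-join-false P Q) (multiplicity-join-false P′ Q′) (multiplicity-join-true P Q) (multiplicity-join-true P′ Q′)

  pointwise-≟-refl : (S : List (Word n)) → pointwise (λ x y → ⌊ x ℕ.≟ y ⌋) S S ≡ true
  pointwise-≟-refl {n} S = trans (allB-cong (λ w → cong ⌊_⌋ (ℕₚ.≟-diag {multiplicity w S} refl)) (words n))
                                 (allB-true (words n))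

  common-complement : (x y z : ℕ) →
    ⌊ x + z ℕ.≟ 1 ⌋ ∧ ⌊ y + z ℕ.≟ 1 ⌋ ≡ ⌊ y ℕ.≟ x ⌋ ∧ ⌊ x + z ℕ.≟ 1 ⌋
  common-complement x y z with y ℕ.≟ x
  ... | yes refl = Boolₚ.∧-idem _
  ... | no y≢x with x + z ℕ.≟ 1 | y + z ℕ.≟ 1
  ...   | yes x+z≡1 | yes y+z≡1 = ⊥-elim (y≢x (ℕₚ.+-cancelʳ-≡ z y x (trans y+z≡1 (sym x+z≡1))))
  ...   | yes _     | no _      = refl
  ...   | no _      | _         = refl

  common-equal : (x y z : ℕ) → ⌊ y ℕ.≟ x ⌋ ∧ ⌊ z ℕ.≟ y ⌋ ≡ ⌊ z ℕ.≟ x ⌋ ∧ ⌊ y ℕ.≟ x ⌋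
  common-equal x y z with y ℕ.≟ x
  ... | yes refl = sym (Boolₚ.∧-identityʳ _)
  ... | no _     = sym (Boolₚ.∧-zeroʳ _)

  -- Perfect matchings of Σ_{n+1} made of b-edges, and invariant subsets

  isPerfect-b-join : (P Q : List (Word n)) →
    isPerfect (map (lb ,_) (join P Q)) ≡ isInvariant actA P ∧ pointwise (λ x y → ⌊ x + y ℕ.≟ 1 ⌋) P Q
  isPerfect-b-join {n} P Q = begin
    isPerfect (map (lb ,_) (join P Q))
      ≡⟨ allB-words-suc (λ v → ⌊ degree (map (lb ,_) (join P Q)) v ℕ.≟ 1 ⌋) ⟩
    allB (λ w → ⌊ degree (map (lb ,_) (join P Q)) (false ∷ w) ℕ.≟ 1 ⌋) (words n) ∧
    allB (λ w → ⌊ degree (map (lb ,_) (join P Q)) (true ∷ w) ℕ.≟ 1 ⌋) (words n)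
      ≡⟨ cong₂ _∧_ (allB-cong (λ w → cong (λ d → ⌊ d ℕ.≟ 1 ⌋) (degree-b-join-false P Q w)) (words n))
                   (allB-cong (λ w → cong (λ d → ⌊ d ℕ.≟ 1 ⌋) (degree-b-join-true P Q w)) (words n)) ⟩
    allB (λ w → ⌊ mP w + mQ w ℕ.≟ 1 ⌋) (words n) ∧ allB (λ w → ⌊ maP w + mQ w ℕ.≟ 1 ⌋) (words n)
      ≡⟨ sym (allB-∧ _ _ (words n)) ⟩
    allB (λ w → ⌊ mP w + mQ w ℕ.≟ 1 ⌋ ∧ ⌊ maP w + mQ w ℕ.≟ 1 ⌋) (words n)
      ≡⟨ allB-cong (λ w → common-complement (mP w) (maP w) (mQ w)) (words n) ⟩
    allB (λ w → ⌊ maP w ℕ.≟ mP w ⌋ ∧ ⌊ mP w + mQ w ℕ.≟ 1 ⌋) (words n)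
      ≡⟨ allB-∧ _ _ (words n) ⟩
    isInvariant actA P ∧ pointwise (λ x y → ⌊ x + y ℕ.≟ 1 ⌋) P Q ∎
    where
    mP mQ maP : Word n → ℕ
    mP w = multiplicity w P
    mQ w = multiplicity w Q
    maP w = multiplicity w (map actA P)

  isInvariant-actA-join : (P Q : List (Word n)) → isInvariant actA (join P Q) ≡ isInvariant actB P ∧ true
  isInvariant-actA-join P Q = trans
    (pointwise-halves (λ x y → ⌊ x ℕ.≟ y ⌋) (map actA (join P Q)) (join P Q) (map actB P) P Q Q
       (multiplicity-actA-join-false P Q) (multiplicity-join-false P Q)
       (multiplicity-actA-join-true P Q) (multiplicity-join-true P Q))
    (cong (isInvariant actB P ∧_) (pointwise-≟-refl Q))

  isInvariant-actB-join : (P Q : List (Word n)) →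
    isInvariant actB (join P Q) ≡ isInvariant actA P ∧ pointwise (λ x y → ⌊ y ℕ.≟ x ⌋) P Q
  isInvariant-actB-join {n} P Q = begin
    isInvariant actB (join P Q)
      ≡⟨ pointwise-halves (λ x y → ⌊ x ℕ.≟ y ⌋) (map actB (join P Q)) (join P Q) Q P (map actA P) Q
           (multiplicity-actB-join-false P Q) (multiplicity-join-false P Q)
           (multiplicity-actB-join-true P Q) (multiplicity-join-true P Q) ⟩
    allB (λ w → ⌊ mQ w ℕ.≟ mP w ⌋) (words n) ∧ allB (λ w → ⌊ maP w ℕ.≟ mQ w ⌋) (words n)
      ≡⟨ sym (allB-∧ _ _ (words n)) ⟩
    allB (λ w → ⌊ mQ w ℕ.≟ mP w ⌋ ∧ ⌊ maP w ℕ.≟ mQ w ⌋) (words n)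
      ≡⟨ allB-cong (λ w → common-equal (mP w) (mQ w) (maP w)) (words n) ⟩
    allB (λ w → ⌊ maP w ℕ.≟ mP w ⌋ ∧ ⌊ mQ w ℕ.≟ mP w ⌋) (words n)
      ≡⟨ allB-∧ _ _ (words n) ⟩
    isInvariant actA P ∧ pointwise (λ x y → ⌊ y ℕ.≟ x ⌋) P Q ∎
    where
    mP mQ maP : Word n → ℕ
    mP w = multiplicity w P
    mQ w = multiplicity w Q
    maP w = multiplicity w (map actA P)

  -- The hypotheses say that R relates each x ∈ {0,1} to exactly one y ∈ {0,1}, which suffices
  -- since multiplicities in subsets are 0 or 1.
  unique-pointwise : (R : ℕ → ℕ → Bool) → countᵇ (R 0) (1 ∷ 0 ∷ []) ≡ 1 → countᵇ (R 1) (1 ∷ 0 ∷ []) ≡ 1 →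
    (n : ℕ) → All (λ P → countᵇ (pointwise R P) (subsets n) ≡ 1) (subsets n)
  unique-pointwise R unique₀ unique₁ zero    = base 1 unique₁ ∷ base 0 unique₀ ∷ []
    where
    base : (x : ℕ) → countᵇ (R x) (1 ∷ 0 ∷ []) ≡ 1 → iverson (R x 1 ∧ true) + (iverson (R x 0 ∧ true) + 0) ≡ 1
    base x = trans (cong₂ (λ r s → iverson r + (iverson s + 0))
                          (Boolₚ.∧-identityʳ (R x 1)) (Boolₚ.∧-identityʳ (R x 0)))
  unique-pointwise R unique₀ unique₁ (suc n) =
    All-subsets-suc _ (All.map (λ {P} unique-P → All.map (λ {P′} unique-P′ →
      trans (countᵇ-subsets-suc-∧ (pointwise R (join P P′)) (pointwise R P) (λ _ → pointwise R P′)
                                  (pointwise-join R P P′) (All.tabulate (λ _ → unique-P′)))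
            (cong (_* 1) unique-P)) IH) IH)
    where
    IH = unique-pointwise R unique₀ unique₁ n

  countInvariant : (n : ℕ) → (Word n → Word n) → ℕ
  countInvariant n σ = countᵇ (isInvariant σ) (subsets n)

  countInvariant-actA-suc : (n : ℕ) → countInvariant (suc n) actA ≡ countInvariant n actB * 2 ^ 2 ^ n
  countInvariant-actA-suc n = countᵇ-subsets-suc-∧ {n = n} (isInvariant actA) (isInvariant actB) (λ _ _ → true)
    isInvariant-actA-join (All.tabulate (λ _ → trans (countᵇ-true (subsets n)) (length-subsets n)))

  countInvariant-actB-suc : (n : ℕ) → countInvariant (suc n) actB ≡ countInvariant n actA
  countInvariant-actB-suc n = trans
    (countᵇ-subsets-suc-∧ {n = n} (isInvariant actB) (isInvariant actA) (pointwise (λ x y → ⌊ y ℕ.≟ x ⌋))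
                          isInvariant-actB-join (unique-pointwise (λ x y → ⌊ y ℕ.≟ x ⌋) refl refl n))
    (ℕₚ.*-identityʳ (countInvariant n actA))

  countᵇ-perfect-b-matchings : (n : ℕ) →
    countᵇ isPerfect (sublists (map (lb ,_) (words (suc n)))) ≡ countInvariant n actA
  countᵇ-perfect-b-matchings n = begin
    countᵇ isPerfect (sublists (map (lb ,_) (words (suc n))))
      ≡⟨ cong (countᵇ isPerfect) (sublists-map (lb ,_) (words (suc n))) ⟩
    countᵇ isPerfect (map (map (lb ,_)) (subsets (suc n)))
      ≡⟨ countᵇ-map isPerfect (map (lb ,_)) (subsets (suc n)) ⟩
    countᵇ (isPerfect ∘ map (lb ,_)) (subsets (suc n))
      ≡⟨ countᵇ-subsets-suc-∧ {n = n} _ (isInvariant actA) (pointwise (λ x y → ⌊ x + y ℕ.≟ 1 ⌋))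
                              isPerfect-b-join (unique-pointwise (λ x y → ⌊ x + y ℕ.≟ 1 ⌋) refl refl n) ⟩
    countInvariant n actA * 1
      ≡⟨ ℕₚ.*-identityʳ (countInvariant n actA) ⟩
    countInvariant n actA ∎

  countᵇ-perfect : (n : ℕ) → countᵇ isPerfect (sublists (edges (suc n))) ≡ countInvariant n actA
  countᵇ-perfect n = begin
    countᵇ isPerfect (sublists (edges (suc n)))
      ≡⟨ countᵇ-sublists-filterᵇ isPerfect labelledB (edges (suc n))
           (All.map (λ loopless → proj₁ ∘ perfect⇒b-edges _ loopless)
                    (All-sublists (edges-loopless (suc n)))) ⟩
    countᵇ isPerfect (sublists (filterᵇ labelledB (edges (suc n))))
      ≡⟨ cong (countᵇ isPerfect ∘ sublists) (filterᵇ-labelledB-edges (words (suc n))) ⟩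
    countᵇ isPerfect (sublists (map (lb ,_) (words (suc n))))
      ≡⟨ countᵇ-perfect-b-matchings n ⟩
    countInvariant n actA ∎

  -- The closed form

  dimerCount : ℕ → ℕ
  dimerCount m = if isOdd m then 2 ^ ((2 ^ m + 1) / 3) else 2 ^ ((2 ^ m + 2) / 3)

  [2^[2+m]+c]/3 : (m c : ℕ) → (2 ^ suc (suc m) + c) / 3 ≡ (2 ^ m + c) / 3 + 2 ^ m
  [2^[2+m]+c]/3 m c = begin
    (2 * (2 * 2 ^ m) + c) / 3        ≡⟨ cong (_/ 3) (split (2 ^ m) c) ⟩
    (2 ^ m + c + 2 ^ m * 3) / 3      ≡⟨ +-distrib-/-∣ʳ (2 ^ m + c) (divides-refl (2 ^ m)) ⟩
    (2 ^ m + c) / 3 + 2 ^ m * 3 / 3  ≡⟨ cong ((2 ^ m + c) / 3 +_) (m*n/n≡m (2 ^ m) 3) ⟩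
    (2 ^ m + c) / 3 + 2 ^ m          ∎
    where
    open +-*-Solver
    split : (x c : ℕ) → 2 * (2 * x) + c ≡ x + c + x * 3
    split = solve 2 (λ x c → con 2 :* (con 2 :* x) :+ c := x :+ c :+ x :* con 3) refl

  dimerCount-suc-suc : (m : ℕ) → dimerCount (suc (suc m)) ≡ dimerCount m * 2 ^ 2 ^ m
  dimerCount-suc-suc m with isOdd m
  ... | true  = trans (cong (2 ^_) ([2^[2+m]+c]/3 m 1)) (ℕₚ.^-distribˡ-+-* 2 ((2 ^ m + 1) / 3) (2 ^ m))
  ... | false = trans (cong (2 ^_) ([2^[2+m]+c]/3 m 2)) (ℕₚ.^-distribˡ-+-* 2 ((2 ^ m + 2) / 3) (2 ^ m))

  countInvariant-actA : (n : ℕ) → countInvariant n actA ≡ dimerCount (suc n)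
  countInvariant-actA zero          = refl
  countInvariant-actA (suc zero)    = refl
  countInvariant-actA (suc (suc n)) = begin
    countInvariant (suc (suc n)) actA         ≡⟨ countInvariant-actA-suc (suc n) ⟩
    countInvariant (suc n) actB * 2 ^ 2 ^ suc n ≡⟨ cong (_* 2 ^ 2 ^ suc n) (countInvariant-actB-suc n) ⟩
    countInvariant n actA * 2 ^ 2 ^ suc n       ≡⟨ cong (_* 2 ^ 2 ^ suc n) (countInvariant-actA n) ⟩
    dimerCount (suc n) * 2 ^ 2 ^ suc n          ≡⟨ sym (dimerCount-suc-suc (suc n)) ⟩
    dimerCount (suc (suc (suc n)))              ∎

open Combinatorics

open import Data.Nat using (ℕ; suc; _+_; _^_; _/_)
open import Data.Bool as Bool using (true; if_then_else_)
import Data.Bool.Properties as Boolₚ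
open import Data.Integer as ℤ using (+_)
import Data.Integer.Properties as ℤₚ
open import Data.Rational using (ℚ; 0ℚ; 1ℚ; _<_; _*_; mkℚ)
import Data.Rational as ℚ
import Data.Rational.Properties as ℚₚ
open import Data.Nat.Coprimality using (1-coprimeTo) renaming (sym to coprime-sym)
open import Data.List using (List; []; _∷_; map; filter; length)
open import Data.List.Relation.Unary.All as All using (All; []; _∷_)
import Data.List.Relation.Unary.All.Properties as Allₚ
open import Data.Product using (_×_; _,_)
open import Relation.Binary.PropositionalEquality using (_≡_; refl; sym; trans; cong; cong₂; module ≡-Reasoning)
open ≡-Reasoning

ℕtoℚ-suc : (k : ℕ) → ℕtoℚ (suc k) ≡ 1ℚ ℚ.+ ℕtoℚ k
ℕtoℚ-suc k = begin
  -- 1ℚ ℚ.+ mkℚ (+ k) 0 _ unfolds to ((+ 1) ℤ.+ (+ k) ℤ.* (+ 1)) / 1.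
  ℕtoℚ (suc k)                      ≡⟨ ℚₚ./-cong {p₁ = + suc k} {q₁ = 1} {p₂ = (+ 1) ℤ.+ (+ k) ℤ.* (+ 1)} {q₂ = 1}
                                                 (cong (ℤ._+_ (+ 1)) (sym (ℤₚ.*-identityʳ (+ k)))) refl ⟩
  1ℚ ℚ.+ mkℚ (+ k) 0 k-coprime-1   ≡⟨ cong (1ℚ ℚ.+_) (sym (ℚₚ.normalize-coprime k-coprime-1)) ⟩
  1ℚ ℚ.+ ℕtoℚ k                     ∎
  where
  k-coprime-1 = coprime-sym (1-coprimeTo k)

sumℚ-map-const : {A : Set} {f : A → ℚ} {c : ℚ} {xs : List A} → All (λ x → f x ≡ c) xs →
                 sumℚ (map f xs) ≡ ℕtoℚ (length xs) * c
sumℚ-map-const {c = c} []                     = sym (ℚₚ.*-zeroˡ c)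
sumℚ-map-const {f = f} {c} {x ∷ xs} (fx≡c ∷ rest) = begin
  f x ℚ.+ sumℚ (map f xs)                   ≡⟨ cong₂ ℚ._+_ fx≡c (sumℚ-map-const rest) ⟩
  c ℚ.+ ℕtoℚ (length xs) * c                ≡⟨ cong (ℚ._+ ℕtoℚ (length xs) * c) (sym (ℚₚ.*-identityˡ c)) ⟩
  1ℚ * c ℚ.+ ℕtoℚ (length xs) * c           ≡⟨ sym (ℚₚ.*-distribʳ-+ c 1ℚ (ℕtoℚ (length xs))) ⟩
  (1ℚ ℚ.+ ℕtoℚ (length xs)) * c             ≡⟨ cong (_* c) (sym (ℕtoℚ-suc (length xs))) ⟩
  ℕtoℚ (suc (length xs)) * c                ∎

prodℚ-weight-b-edges : {n : ℕ} (a b : ℚ) {M : List (Edge n)} → All (λ e → labelledB e ≡ true) M →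
                       prodℚ (map (weight a b) M) ≡ b ^ℚ length M
prodℚ-weight-b-edges a b []                              = refl
prodℚ-weight-b-edges a b {(lb , _) ∷ _} (_ ∷ rest) = cong (b *_) (prodℚ-weight-b-edges a b rest)

Φ-suc : (n : ℕ) (a b : ℚ) → Φ (suc n) a b ≡ ℕtoℚ (countᵇ isPerfect (sublists (edges (suc n)))) * (b ^ℚ (2 ^ n))
Φ-suc n a b = begin
  sumℚ (map (λ M → prodℚ (map (weight a b) M)) perfect)
    ≡⟨ sumℚ-map-const (All.map weight-perfect perfect-loopless) ⟩
  ℕtoℚ (length perfect) * (b ^ℚ (2 ^ n))
    ≡⟨ cong (λ k → ℕtoℚ k * (b ^ℚ (2 ^ n))) (length-filter-≟-true isPerfect (sublists (edges (suc n)))) ⟩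
  ℕtoℚ (countᵇ isPerfect (sublists (edges (suc n)))) * (b ^ℚ (2 ^ n)) ∎
  where
  perfect? = λ (M : List (Edge (suc n))) → isPerfect M Bool.≟ true
  perfect = filter perfect? (sublists (edges (suc n)))
  perfect-loopless : All (λ M → All Loopless M × isPerfect M ≡ true) perfect
  perfect-loopless = All.zip (Allₚ.filter⁺ perfect? (All-sublists (edges-loopless (suc n))) ,
                              Allₚ.all-filter perfect? (sublists (edges (suc n))))
  weight-perfect : {M : List (Edge (suc n))} → All Loopless M × isPerfect M ≡ true →
                   prodℚ (map (weight a b) M) ≡ b ^ℚ (2 ^ n)
  weight-perfect {M} (loopless , is-perfect) with perfect⇒b-edges M loopless is-perfect
  ... | all-b , length≡2^n = trans (prodℚ-weight-b-edges a b all-b) (cong (b ^ℚ_) length≡2^n)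

theorem2p7 : (n : ℕ) → (a b : ℚ) → 0ℚ < a → 0ℚ < b →
    Φ (suc n) a b ≡
      (if isOdd (suc n)
         then ℕtoℚ (2 ^ ((2 ^ suc n + 1) / 3)) * (b ^ℚ (2 ^ n))
         else ℕtoℚ (2 ^ ((2 ^ suc n + 2) / 3)) * (b ^ℚ (2 ^ n)))
theorem2p7 n a b _ _ = begin
  Φ (suc n) a b
    ≡⟨ Φ-suc n a b ⟩
  ℕtoℚ (countᵇ isPerfect (sublists (edges (suc n)))) * (b ^ℚ (2 ^ n))
    ≡⟨ cong (λ k → ℕtoℚ k * (b ^ℚ (2 ^ n))) (trans (countᵇ-perfect n) (countInvariant-actA n)) ⟩
  ℕtoℚ (dimerCount (suc n)) * (b ^ℚ (2 ^ n))
    ≡⟨ Boolₚ.if-float (λ k → ℕtoℚ k * (b ^ℚ (2 ^ n))) (isOdd (suc n)) ⟩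
  (if isOdd (suc n)
     then ℕtoℚ (2 ^ ((2 ^ suc n + 1) / 3)) * (b ^ℚ (2 ^ n))
     else ℕtoℚ (2 ^ ((2 ^ suc n + 2) / 3)) * (b ^ℚ (2 ^ n))) ∎
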